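{- The bucketing function $f$ produced by the construction described in the context is $(1,2)$-sensitive; in fact, for all $s,t\in\mathcal{S}_n$, $\mathrm{edit}(s,t)\le1$ if and only if $f(s)\cap f(t)\neq\emptyset$.
   Context: $\Sigma$ is a finite alphabet with $|\Sigma|>1$, $n\ge1$, $\mathcal{S}_n=\Sigma^n$ with edit (Levenshtein) distance $\mathrm{edit}$. A bucketing function $f:\mathcal{S}_n\to\mathcal{P}(B)$ is $(d_1,d_2)$-sensitive if for all $s,t$: $\mathrm{edit}(s,t)\le d_1\Rightarrow f(s)\cap f(t)\ne\emptyset$ and $\mathrm{edit}(s,t)\ge d_2\Rightarrow f(s)\cap f(t)=\emptyset$. Construction: fix a bijection $\sigma:\{1,\ldots,|\Sigma|\}\to\Sigma$; initialize $f(s)=\emptyset$ for all $s$ and a counter $m=1$. Process the sequences $s=s_1\cdots s_n\in\mathcal{S}_n$ in an arbitrary order; for each $s$ and each $i=1,\ldots,n$, if $s_i=\sigma(1)$ then for every $j=1,\ldots,|\Sigma|$ add bucket $m$ to $f(t)$ where $t=s_1\cdots s_{i-1}\sigma(j)s_{i+1}\cdots s_n$, and then increment $m$. -}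

module Defs where

open import Data.Nat using (ℕ; zero; suc; _+_; _⊓_)
open import Data.Fin using (Fin)
import Data.Fin.Properties as FinP
open import Data.List using (List; []; _∷_; length; foldl)
open import Data.List.Membership.Propositional using (_∈_)
open import Data.Vec using (Vec; toList; lookup; _[_]≔_; allFin)
import Data.Vec as V
import Data.Vec.Properties as VecP
open import Data.Product using (_×_; _,_; proj₂; ∃)
open import Function.Bundles using (_↔_; Inverse)
open import Relation.Binary.Definitions using (DecidableEquality)
open import Relation.Binary.PropositionalEquality using (_≡_; refl; cong; sym; trans)
open import Relation.Nullary using (yes; no; ¬_)

-- Decidable equality on the alphabet, derived from the bijection σ : Fin k ↔ A.
-- The alphabet has size suc k; σ : {1,…,suc k} → A is a bijection, σ(1) = to zero.
module _ {A : Set} {k : ℕ} (σ : Fin (suc k) ↔ A) where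
  open Inverse σ

  decA : DecidableEquality A
  decA a b with FinP._≟_ (from a) (from b)
  ... | yes p = yes (trans (sym (strictlyInverseˡ a)) (trans (cong to p) (strictlyInverseˡ b)))
  ... | no ¬p = no (λ a≡b → ¬p (cong from a≡b))

  editL : List A → List A → ℕ
  editL [] ys = length ys
  editL (x ∷ xs) [] = length (x ∷ xs)
  editL (x ∷ xs) (y ∷ ys) =
    suc (editL xs (y ∷ ys)) ⊓ (suc (editL (x ∷ xs) ys) ⊓ (editL xs ys + subst-cost))
    where
    subst-cost : ℕ
    subst-cost with decA x y
    ... | yes _ = 0
    ... | no _  = 1

  edit : {n : ℕ} → Vec A n → Vec A n → ℕ
  edit s t = editL (toList s) (toList t)

  Buckets : ℕ → Set
  Buckets n = Vec A n → List ℕ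

  addBucket : {n : ℕ} → ℕ → Vec A n → Buckets n → Buckets n
  addBucket {n} m t f u with VecP.≡-dec decA u t
  ... | yes _ = m ∷ f u
  ... | no _  = f u

  addAllSubst : {n : ℕ} → ℕ → Vec A n → Fin n → Buckets n → Buckets n
  addAllSubst m s i f = foldl (λ g j → addBucket m (s [ i ]≔ to j) g) f (toList (allFin (suc k)))

  processPos : {n : ℕ} → Vec A n → ℕ × Buckets n → Fin n → ℕ × Buckets n
  processPos s (m , f) i with decA (lookup s i) (to Fin.zero)
    where open import Data.Fin using (zero)
  ... | yes _ = (suc m , addAllSubst m s i f)
  ... | no _  = (m , f)

  processSeq : {n : ℕ} → ℕ × Buckets n → Vec A n → ℕ × Buckets n
  processSeq s₀ s = foldl (processPos s) s₀ (toList (allFin _))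

  bucketing : {n : ℕ} → List (Vec A n) → Buckets n
  bucketing order = proj₂ (foldl processSeq (1 , (λ _ → [])) order)

Intersect : List ℕ → List ℕ → Set
Intersect X Y = ∃ λ m → m ∈ X × m ∈ Y

IsSensitive : {S : Set} → (S → S → ℕ) → (S → List ℕ) → ℕ → ℕ → Set
IsSensitive dist f d₁ d₂ =
  (∀ s t → dist s t Data.Nat.≤ d₁ → Intersect (f s) (f t)) ×
  (∀ s t → d₂ Data.Nat.≤ dist s t → ¬ Intersect (f s) (f t))

-- Bucket m is handed out once, to the |Σ| words s[i := a] for one pair (s, i), and each later
-- bucket is numbered above every earlier one, so any two words sharing a bucket differ in at
-- most one position. Conversely, if u and v differ at most at position i, the word s obtained
-- by putting σ(1) at position i creates a bucket shared by s[i := u i] = u and s[i := v i] = v.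
-- Finally, for words of equal length, edit distance at most 1 is the same as agreeing outside
-- one position: a single insertion or deletion would change the length.
module Submission where

open import Defs
open import Data.Nat using (ℕ; suc; _≤_)
open import Data.Fin using (Fin)
open import Data.Vec using (Vec)
open import Data.List using (List)
open import Data.List.Relation.Unary.Unique.Propositional using (Unique)
open import Data.List.Membership.Propositional using (_∈_)
open import Data.Product using (_×_)
open import Function.Bundles using (_↔_; _⇔_)

open import Data.Nat using (zero; _⊓_; _<_; s≤s)
open import Data.Nat.Properties
  using (⊓-sel; m⊓n≤n; ≤-trans; ≤-reflexive; ≤⇒≯; n≤0⇒n≡0; +-identityʳ; +-comm;
         1+n≢n; n<1+n; m≤n⇒m≤1+n; <-irrefl)
open import Data.Fin using (zero; suc)
open import Data.List using ([]; _∷_; foldl; length)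
open import Data.List.Relation.Unary.Any using (here; there)
open import Data.Vec using ([]; _∷_; toList; lookup; _[_]≔_; allFin)
open import Data.Vec.Properties
  using (length-toList; toList-injective; cast-is-id; ∷-injectiveˡ; ∷-injectiveʳ;
         ≡-dec; []≔-idempotent; []≔-lookup; lookup∘update)
open import Data.Vec.Membership.Propositional.Properties using (∈-toList⁺; ∈-allFin⁺)
open import Data.Product using (_,_; proj₂; ∃-syntax)
open import Data.Sum using (_⊎_; inj₁; inj₂)
import Data.Sum as Sum
open import Data.Empty using (⊥-elim)
open import Function using (_∘_)
open import Function.Bundles using (Inverse; mk⇔)
open import Relation.Binary.PropositionalEquality
  using (_≡_; _≢_; refl; sym; trans; cong; cong₂; subst; subst₂; module ≡-Reasoning)
open import Relation.Nullary using (yes; no; ¬_)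

⊓-≤-cases : ∀ m n {o} → m ⊓ n ≤ o → m ≤ o ⊎ n ≤ o
⊓-≤-cases m n m⊓n≤o with ⊓-sel m n
... | inj₁ m⊓n≡m = inj₁ (subst (_≤ _) m⊓n≡m m⊓n≤o)
... | inj₂ m⊓n≡n = inj₂ (subst (_≤ _) m⊓n≡n m⊓n≤o)

⊓₃-≤-cases : ∀ {m n o p} → m ⊓ (n ⊓ o) ≤ p → m ≤ p ⊎ n ≤ p ⊎ o ≤ p
⊓₃-≤-cases {m} {n} = Sum.map₂ (⊓-≤-cases n _) ∘ ⊓-≤-cases m _

module _ {B X : Set} (P : B → Set) {g : B → X → B} (preserves : ∀ b x → P b → P (g b x)) where

  foldl-preserves : ∀ xs {b} → P b → P (foldl g b xs)
  foldl-preserves []       pb = pb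
  foldl-preserves (x ∷ xs) pb = foldl-preserves xs (preserves _ x pb)

  foldl-establishes : ∀ {x xs} → x ∈ xs → (∀ b → P (g b x)) → ∀ b → P (foldl g b xs)
  foldl-establishes {xs = _ ∷ xs} (here refl) establish b = foldl-preserves xs (establish b)
  foldl-establishes {xs = y ∷ _}  (there x∈) establish b = foldl-establishes x∈ establish (g b y)

module _ {A : Set} where

  AgreeOutside : ∀ {n} → Fin n → Vec A n → Vec A n → Set
  AgreeOutside i u v = u ≡ v [ i ]≔ lookup u i

  agreeOutside-refl : ∀ {n} (i : Fin n) u → AgreeOutside i u u
  agreeOutside-refl i u = sym ([]≔-lookup u i)

  agreeOutside-[]≔ : ∀ {n} (s : Vec A n) i a b → AgreeOutside i (s [ i ]≔ a) (s [ i ]≔ b)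
  agreeOutside-[]≔ s i a b = sym (begin
    (s [ i ]≔ b) [ i ]≔ lookup (s [ i ]≔ a) i ≡⟨ cong ((s [ i ]≔ b) [ i ]≔_) (lookup∘update i s a) ⟩
    (s [ i ]≔ b) [ i ]≔ a                     ≡⟨ []≔-idempotent s i ⟩
    s [ i ]≔ a                                ∎)
    where open ≡-Reasoning

  toList≢∷toList : ∀ {n} (xs : Vec A n) y (ys : Vec A n) → toList xs ≢ y ∷ toList ys
  toList≢∷toList xs y ys eq = 1+n≢n (begin
    suc (length (toList ys)) ≡⟨ cong length eq ⟨
    length (toList xs)       ≡⟨ length-toList xs ⟩
    _                        ≡⟨ length-toList ys ⟨
    length (toList ys)       ∎)
    where open ≡-Reasoning

  toList-injective′ : ∀ {n} (xs ys : Vec A n) → toList xs ≡ toList ys → xs ≡ ys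
  toList-injective′ xs ys eq = trans (sym (cast-is-id refl xs)) (toList-injective refl xs ys eq)

module _ {A : Set} {k : ℕ} (σ : Fin (suc k) ↔ A) where
  open Inverse σ using (to; from; strictlyInverseˡ)

  editL-∷-same : ∀ x xs ys → editL σ (x ∷ xs) (x ∷ ys) ≤ editL σ xs ys
  editL-∷-same x xs ys with decA σ x x
  ... | yes _  = ≤-trans (≤-trans (m⊓n≤n _ _) (m⊓n≤n _ _)) (≤-reflexive (+-identityʳ _))
  ... | no x≢x = ⊥-elim (x≢x refl)

  editL-∷-≤-suc : ∀ x y xs ys → editL σ (x ∷ xs) (y ∷ ys) ≤ suc (editL σ xs ys)
  editL-∷-≤-suc x y xs ys with decA σ x y
  ... | yes _ = ≤-trans (≤-trans (m⊓n≤n _ _) (m⊓n≤n _ _))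
                        (m≤n⇒m≤1+n (≤-reflexive (+-identityʳ _)))
  ... | no _  = ≤-trans (≤-trans (m⊓n≤n _ _) (m⊓n≤n _ _)) (≤-reflexive (+-comm _ 1))

  editL-refl : ∀ xs → editL σ xs xs ≡ 0
  editL-refl []       = refl
  editL-refl (x ∷ xs) = n≤0⇒n≡0 (≤-trans (editL-∷-same x xs xs) (≤-reflexive (editL-refl xs)))

  editL-∷-≤-cases : ∀ {d} x y xs ys → editL σ (x ∷ xs) (y ∷ ys) ≤ d →
                    suc (editL σ xs (y ∷ ys)) ≤ d ⊎ suc (editL σ (x ∷ xs) ys) ≤ d ⊎
                    (x ≡ y × editL σ xs ys ≤ d) ⊎ (x ≢ y × suc (editL σ xs ys) ≤ d)
  editL-∷-≤-cases x y xs ys d≤ with decA σ x y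
  ... | yes x≡y = Sum.map₂ (Sum.map₂ (λ sub → inj₁ (x≡y , ≤-trans (≤-reflexive (sym (+-identityʳ _))) sub)))
                  (⊓₃-≤-cases d≤)
  ... | no x≢y  = Sum.map₂ (Sum.map₂ (λ sub → inj₂ (x≢y , ≤-trans (≤-reflexive (+-comm 1 _)) sub)))
                  (⊓₃-≤-cases d≤)

  editL≤0⇒≡ : ∀ xs ys → editL σ xs ys ≤ 0 → xs ≡ ys
  editL≤0⇒≡ []       []       _   = refl
  editL≤0⇒≡ (x ∷ xs) (y ∷ ys) d≤0 with editL-∷-≤-cases x y xs ys d≤0
  ... | inj₂ (inj₂ (inj₁ (x≡y , d≤0′))) = cong₂ _∷_ x≡y (editL≤0⇒≡ xs ys d≤0′)

  edit≤0⇒≡ : ∀ {n} (u v : Vec A n) → edit σ u v ≤ 0 → u ≡ v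
  edit≤0⇒≡ u v = toList-injective′ u v ∘ editL≤0⇒≡ (toList u) (toList v)

  edit≤1⇒agreeOutside : ∀ {n} (u v : Vec A n) → edit σ u v ≤ 1 → u ≡ v ⊎ ∃[ i ] AgreeOutside i u v
  edit≤1⇒agreeOutside []       []       _   = inj₁ refl
  edit≤1⇒agreeOutside (x ∷ xs) (y ∷ ys) d≤1 with editL-∷-≤-cases x y (toList xs) (toList ys) d≤1
  ... | inj₁ (s≤s del)                   = ⊥-elim (toList≢∷toList xs y ys (editL≤0⇒≡ _ _ del))
  ... | inj₂ (inj₁ (s≤s ins))            = ⊥-elim (toList≢∷toList ys x xs (sym (editL≤0⇒≡ _ _ ins)))
  ... | inj₂ (inj₂ (inj₂ (_ , s≤s sub))) = inj₂ (zero , cong (x ∷_) (edit≤0⇒≡ xs ys sub))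
  ... | inj₂ (inj₂ (inj₁ (refl , sub))) =
    Sum.map (cong (x ∷_)) (λ (i , agree) → suc i , cong (x ∷_) agree) (edit≤1⇒agreeOutside xs ys sub)

  agreeOutside⇒edit≤1 : ∀ {n} i (u v : Vec A n) → AgreeOutside i u v → edit σ u v ≤ 1
  agreeOutside⇒edit≤1 zero (x ∷ xs) (y ∷ .xs) refl =
    ≤-trans (editL-∷-≤-suc x y (toList xs) (toList xs)) (s≤s (≤-reflexive (editL-refl (toList xs))))
  agreeOutside⇒edit≤1 (suc i) (x ∷ xs) (y ∷ ys) agree with refl ← ∷-injectiveˡ agree =
    ≤-trans (editL-∷-same x (toList xs) (toList ys)) (agreeOutside⇒edit≤1 i xs ys (∷-injectiveʳ agree))

  _⊆ᴮ_ : ∀ {n} → Buckets σ n → Buckets σ n → Set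
  f ⊆ᴮ g = ∀ {u l} → l ∈ f u → l ∈ g u

  module _ {n} (m : ℕ) (t : Vec A n) (f : Buckets σ n) where

    ∈-addBucket⁻ : ∀ {u l} → l ∈ addBucket σ m t f u → l ∈ f u ⊎ (l ≡ m × u ≡ t)
    ∈-addBucket⁻ {u} l∈ with ≡-dec (decA σ) u t
    ∈-addBucket⁻ (here l≡m) | yes u≡t = inj₂ (l≡m , u≡t)
    ∈-addBucket⁻ (there l∈) | yes _   = inj₁ l∈
    ∈-addBucket⁻ l∈         | no _    = inj₁ l∈

    addBucket-⊇ : f ⊆ᴮ addBucket σ m t f
    addBucket-⊇ {u} l∈ with ≡-dec (decA σ) u t
    ... | yes _ = there l∈
    ... | no _  = l∈

    m∈addBucket : m ∈ addBucket σ m t f t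
    m∈addBucket with ≡-dec (decA σ) t t
    ... | yes _  = here refl
    ... | no t≢t = ⊥-elim (t≢t refl)

  module _ {n} (m : ℕ) (s : Vec A n) (i : Fin n) where

    ∈-addAllSubst⁻ : ∀ f {u l} → l ∈ addAllSubst σ m s i f u → l ∈ f u ⊎ (l ≡ m × ∃[ a ] u ≡ s [ i ]≔ a)
    ∈-addAllSubst⁻ f = foldl-preserves OnlyNewAtSubst extend (toList (allFin (suc k))) inj₁
      where
      OnlyNewAtSubst : Buckets σ n → Set
      OnlyNewAtSubst g = ∀ {u l} → l ∈ g u → l ∈ f u ⊎ (l ≡ m × ∃[ a ] u ≡ s [ i ]≔ a)

      extend : ∀ g j → OnlyNewAtSubst g → OnlyNewAtSubst (addBucket σ m (s [ i ]≔ to j) g)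
      extend g j g-new l∈ with ∈-addBucket⁻ m (s [ i ]≔ to j) g l∈
      ... | inj₁ l∈g          = g-new l∈g
      ... | inj₂ (l≡m , u≡t) = inj₂ (l≡m , to j , u≡t)

    addAllSubst-⊇ : ∀ f → f ⊆ᴮ addAllSubst σ m s i f
    addAllSubst-⊇ f {u} {l} =
      foldl-preserves (λ g → l ∈ g u) (λ g j → addBucket-⊇ m _ g) (toList (allFin (suc k)))

    m∈addAllSubst : ∀ f j → m ∈ addAllSubst σ m s i f (s [ i ]≔ to j)
    m∈addAllSubst f j = foldl-establishes (λ g → m ∈ g (s [ i ]≔ to j)) (λ g j′ → addBucket-⊇ m _ g)
      (∈-toList⁺ (∈-allFin⁺ j)) (m∈addBucket m (s [ i ]≔ to j)) f

  State : ℕ → Set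
  State n = ℕ × Buckets σ n

  Shares : ∀ {n} → Vec A n → Vec A n → State n → Set
  Shares u v (_ , f) = Intersect (f u) (f v)

  shares-preserved : ∀ {n} {X : Set} (u v : Vec A n) (step : State n → X → State n) →
                     (∀ st x → proj₂ st ⊆ᴮ proj₂ (step st x)) →
                     ∀ st x → Shares u v st → Shares u v (step st x)
  shares-preserved u v step grows st x (l , l∈u , l∈v) = l , grows st x l∈u , grows st x l∈v

  processPos-⊇ : ∀ {n} (s : Vec A n) st i → proj₂ st ⊆ᴮ proj₂ (processPos σ s st i)
  processPos-⊇ s (m , f) i with decA σ (lookup s i) (to zero)
  ... | yes _ = addAllSubst-⊇ m s i f
  ... | no _  = λ l∈ → l∈

  processSeq-⊇ : ∀ {n} (st : State n) s → proj₂ st ⊆ᴮ proj₂ (processSeq σ st s)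
  processSeq-⊇ st s = foldl-preserves (λ st′ → proj₂ st ⊆ᴮ proj₂ st′)
    (λ st′ i st⊆st′ l∈ → processPos-⊇ s st′ i (st⊆st′ l∈)) (toList (allFin _)) (λ l∈ → l∈)

  processPos-shares : ∀ {n} (s : Vec A n) i → lookup s i ≡ to zero →
                      ∀ j j′ st → Shares (s [ i ]≔ to j) (s [ i ]≔ to j′) (processPos σ s st i)
  processPos-shares s i sᵢ≡σ₁ j j′ (m , f) with decA σ (lookup s i) (to zero)
  ... | yes _     = m , m∈addAllSubst m s i f j , m∈addAllSubst m s i f j′
  ... | no sᵢ≢σ₁ = ⊥-elim (sᵢ≢σ₁ sᵢ≡σ₁)

  processSeq-shares : ∀ {n} (s : Vec A n) i → lookup s i ≡ to zero →
                      ∀ j j′ st → Shares (s [ i ]≔ to j) (s [ i ]≔ to j′) (processSeq σ st s)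
  processSeq-shares s i sᵢ≡σ₁ j j′ = foldl-establishes (Shares u v)
    (shares-preserved u v (processPos σ s) (processPos-⊇ s)) (∈-toList⁺ (∈-allFin⁺ i))
    (processPos-shares s i sᵢ≡σ₁ j j′)
    where
    u = s [ i ]≔ to j
    v = s [ i ]≔ to j′

  bucketing-complete : ∀ {n} (order : List (Vec A n)) → (∀ s → s ∈ order) → ∀ {i u v} →
                       AgreeOutside i u v → Intersect (bucketing σ order u) (bucketing σ order v)
  bucketing-complete order all {i} {u} {v} agree =
    subst₂ (λ u′ v′ → Shares u′ v′ (foldl (processSeq σ) (1 , λ _ → []) order))
           (restore u agree) (restore v (agreeOutside-refl i v))
           (foldl-establishes (Shares (s [ i ]≔ to j) (s [ i ]≔ to j′))
             (shares-preserved _ _ (processSeq σ) processSeq-⊇) (all s)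
             (processSeq-shares s i (lookup∘update i v (to zero)) j j′) (1 , λ _ → []))
    where
    s = v [ i ]≔ to zero
    j = from (lookup u i)
    j′ = from (lookup v i)

    restore : ∀ w → AgreeOutside i w v → s [ i ]≔ to (from (lookup w i)) ≡ w
    restore w w≈v = begin
      s [ i ]≔ to (from (lookup w i)) ≡⟨ []≔-idempotent v i ⟩
      v [ i ]≔ to (from (lookup w i)) ≡⟨ cong (v [ i ]≔_) (strictlyInverseˡ (lookup w i)) ⟩
      v [ i ]≔ lookup w i             ≡⟨ w≈v ⟨
      w                               ∎
      where open ≡-Reasoning

  LabelsBelow : ∀ {n} → ℕ → Buckets σ n → Set
  LabelsBelow m f = ∀ {u l} → l ∈ f u → l < m

  SharingIsLocal : ∀ {n} → Buckets σ n → Set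
  SharingIsLocal f = ∀ {u v l} → l ∈ f u → l ∈ f v → ∃[ i ] AgreeOutside i u v

  Invariant : ∀ {n} → State n → Set
  Invariant (m , f) = LabelsBelow m f × SharingIsLocal f

  processPos-invariant : ∀ {n} (s : Vec A n) st i → Invariant st → Invariant (processPos σ s st i)
  processPos-invariant s (m , f) i (below , local) with decA σ (lookup s i) (to zero)
  ... | no _  = below , local
  ... | yes _ = below′ , local′
    where
    below′ : LabelsBelow (suc m) (addAllSubst σ m s i f)
    below′ l∈ with ∈-addAllSubst⁻ m s i f l∈
    ... | inj₁ l∈f        = m≤n⇒m≤1+n (below l∈f)
    ... | inj₂ (refl , _) = n<1+n m

    local′ : SharingIsLocal (addAllSubst σ m s i f)
    local′ l∈u l∈v with ∈-addAllSubst⁻ m s i f l∈u | ∈-addAllSubst⁻ m s i f l∈v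
    ... | inj₁ l∈fu              | inj₁ l∈fv          = local l∈fu l∈fv
    ... | inj₁ l∈fu              | inj₂ (refl , _)    = ⊥-elim (<-irrefl refl (below l∈fu))
    ... | inj₂ (refl , _)        | inj₁ l∈fv          = ⊥-elim (<-irrefl refl (below l∈fv))
    ... | inj₂ (refl , a , refl) | inj₂ (_ , b , refl) = i , agreeOutside-[]≔ s i a b

  processSeq-invariant : ∀ {n} (st : State n) s → Invariant st → Invariant (processSeq σ st s)
  processSeq-invariant st s = foldl-preserves Invariant (processPos-invariant s) (toList (allFin _))

  bucketing-sound : ∀ {n} (order : List (Vec A n)) {u v} →
                    Intersect (bucketing σ order u) (bucketing σ order v) → ∃[ i ] AgreeOutside i u v
  bucketing-sound order (l , l∈u , l∈v) =
    proj₂ (foldl-preserves Invariant processSeq-invariant order ((λ ()) , (λ ()))) l∈u l∈v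

lemma5 : {A : Set} (k : ℕ) → 2 ≤ suc k → (σ : Fin (suc k) ↔ A) → (n : ℕ) → 1 ≤ n →
         (order : List (Vec A n)) → Unique order → (∀ s → s ∈ order) →
         IsSensitive (edit σ) (bucketing σ order) 1 2 ×
         (∀ s t → (edit σ s t ≤ 1) ⇔ Intersect (bucketing σ order s) (bucketing σ order t))
lemma5 k _ σ (suc n) _ order _ all =
  (near⇒shared , far⇒disjoint) , λ s t → mk⇔ (near⇒shared s t) (shared⇒near s t)
  where
  near⇒shared : ∀ s t → edit σ s t ≤ 1 → Intersect (bucketing σ order s) (bucketing σ order t)
  near⇒shared s t d≤1 with edit≤1⇒agreeOutside σ s t d≤1
  ... | inj₁ refl        = bucketing-complete σ order all (agreeOutside-refl zero s)
  ... | inj₂ (_ , agree) = bucketing-complete σ order all agree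

  shared⇒near : ∀ s t → Intersect (bucketing σ order s) (bucketing σ order t) → edit σ s t ≤ 1
  shared⇒near s t shared =
    let i , agree = bucketing-sound σ order shared in agreeOutside⇒edit≤1 σ i s t agree

  far⇒disjoint : ∀ s t → 2 ≤ edit σ s t → ¬ Intersect (bucketing σ order s) (bucketing σ order t)
  far⇒disjoint s t 2≤d shared = ≤⇒≯ (shared⇒near s t shared) 2≤d
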